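{- Let $G$ be a connected $(P_3+P_2)$-free graph and let $x,y$ be adjacent vertices of $G$. Let $G_{xy}=G-\{x,y\}$, let $A_{xy}$ be the set of vertices of $G_{xy}$ adjacent to $x$ or $y$, and $B_{xy}=V(G_{xy})\setminus A_{xy}$; assume every vertex of $B_{xy}$ has a neighbor in $A_{xy}$. Let $\gamma''(G_{xy})$ be the minimum cardinality of a subset of $A_{xy}$ dominating $B_{xy}$. Let $A'_{xy}$ be the set of vertices $z\in A_{xy}$ that have a neighbor in $B_{xy}$ and such that $B_{xy}\setminus N(z)$ is an independent set. For $z\in A'_{xy}$ let $H^z=G-(\{z\}\cup(N(z)\cap B_{xy}))$, and let $\gamma''(H^z_{xy})$ be the minimum cardinality of a subset of $A_{xy}\setminus\{z\}$ dominating $B_{xy}\setminus N(z)$ (these being the sets playing the roles of $A_{xy}$ and $B_{xy}$ for the edge $xy$ in $H^z$). If $\gamma(G)\ge 4$, then $\gamma''(G_{xy})=\min_{z\in A'_{xy}}\gamma''(H^z_{xy})+1$.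
   Context: $P_3+P_2$ is the disjoint union of a path on 3 vertices and a path on 2 vertices; "$H$-free" means having no induced subgraph isomorphic to $H$. $N(v)$ is the (open) neighborhood of $v$. A set $V'$ dominates $V''$ if every vertex of $V''\setminus V'$ has a neighbor in $V'$. $\gamma(G)$ is the domination number of $G$. -}

module Defs where

open import Data.Nat using (ℕ; _≤_)
open import Data.Fin using (Fin)
open import Data.Fin.Subset using (Subset; _∈_; _∉_; ∣_∣)
open import Data.Product using (Σ; ∃; _×_; _,_)
open import Data.Sum using (_⊎_)
open import Data.Unit using (⊤)
open import Relation.Nullary using (¬_; Dec)
open import Relation.Binary.PropositionalEquality using (_≡_; _≢_)
open import Relation.Binary.Construct.Closure.ReflexiveTransitive using (Star)

record Graph (n : ℕ) : Set₁ where
  field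
    Adj     : Fin n → Fin n → Set
    sym     : ∀ {u v} → Adj u v → Adj v u
    irrefl  : ∀ {u} → ¬ Adj u u
    adj?    : ∀ u v → Dec (Adj u v)

module _ {n : ℕ} (G : Graph n) where
  open Graph G

  Connected : Set
  Connected = ∀ u v → Star Adj u v

  record InducedP3P2 (a b c d e : Fin n) : Set where
    field
      ab : a ≢ b
      ac : a ≢ c
      ad : a ≢ d
      ae : a ≢ e
      bc : b ≢ c
      bd : b ≢ d
      be : b ≢ e
      cd : c ≢ d
      ce : c ≢ e
      de : d ≢ e
      e-ab : Adj a b
      e-bc : Adj b c
      e-de : Adj d e
      n-ac : ¬ Adj a c
      n-ad : ¬ Adj a d
      n-ae : ¬ Adj a e
      n-bd : ¬ Adj b d
      n-be : ¬ Adj b e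
      n-cd : ¬ Adj c d
      n-ce : ¬ Adj c e

  P3+P2-free : Set
  P3+P2-free = ∀ a b c d e → ¬ InducedP3P2 a b c d e

  Dominates : Subset n → (Fin n → Set) → Set
  Dominates S T = ∀ v → T v → v ∉ S → ∃ λ u → u ∈ S × Adj u v

  DomNumAtLeast : ℕ → Set
  DomNumAtLeast k = ∀ (S : Subset n) → Dominates S (λ _ → ⊤) → k ≤ ∣ S ∣

  IsMinCard : (Subset n → Set) → ℕ → Set
  IsMinCard P k = (∃ λ S → P S × ∣ S ∣ ≡ k) × (∀ S → P S → k ≤ ∣ S ∣)

  module Edge (x y : Fin n) where
    Gxy : Fin n → Set
    Gxy v = v ≢ x × v ≢ y
    A : Fin n → Set
    A v = Gxy v × (Adj v x ⊎ Adj v y)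
    B : Fin n → Set
    B v = Gxy v × ¬ (Adj v x ⊎ Adj v y)

    γ''Gxy : ℕ → Set
    γ''Gxy = IsMinCard (λ S → (∀ v → v ∈ S → A v) × Dominates S B)

    BminusN : Fin n → Fin n → Set
    BminusN z v = B v × ¬ Adj z v

    A' : Fin n → Set
    A' z = A z × (∃ λ b → B b × Adj z b)
               × (∀ b b' → BminusN z b → BminusN z b' → ¬ Adj b b')

    γ''Hz : Fin n → ℕ → Set
    γ''Hz z = IsMinCard (λ S → (∀ v → v ∈ S → A v × v ≢ z) × Dominates S (BminusN z))

module Submission where

-- Proof idea.  Fix a minimum set D ⊆ A_xy dominating B_xy, so |D| = γ''(G_xy).
--
-- * Adding z to a subset of A_xy \ {z} that dominates B_xy \ N(z) gives a subset
--   of A_xy dominating B_xy, hence γ''(G_xy) ≤ γ''(H^z_xy) + 1 for every z; and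
--   if z ∈ D then D - z dominates B_xy \ N(z), hence γ''(H^z_xy) = |D| - 1.
-- * So it suffices to find some z ∈ D lying in A'_xy.  This uses P3+P2-freeness
--   twice: B_xy induces a disjoint union of cliques (an induced P3 in B_xy plus
--   the edge xy would be a P3+P2), and a vertex z ∈ A_xy with a neighbour u ∈ B_xy
--   that misses an edge bb' of B_xy forces u to see both b and b' (otherwise
--   u - z - x/y plus bb' is a P3+P2).
-- * Since γ(G) ≥ 4, some b₀ ∈ B_xy is undominated by {x, y}; let z₀ ∈ D dominate
--   it.  If B_xy \ N(z₀) is independent we are done.  Otherwise, again by
--   γ(G) ≥ 4, some v ∈ B_xy avoids N[{x, y, b₀}]; its dominator z ∈ D must then
--   have B_xy \ N(z) independent, as an edge there would yield a P3+P2.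

open import Defs
open import Data.Nat using (ℕ; suc; _≤_; _<_; _+_; z≤n; s≤s; s≤s⁻¹)
open import Data.Nat.Properties
  using (≤-trans; ≤-reflexive; ≤-antisym; +-monoʳ-≤; +-suc; <⇒≱)
open import Data.Fin as Fin using (Fin; _≟_)
open import Data.Fin.Properties using (any?; all?)
open import Data.Fin.Subset using (Subset; _∈_; _∉_; ∣_∣; ⁅_⁆; _∪_; _-_; ⊥; inside; outside)
open import Data.Fin.Subset.Properties
  using (_∈?_; x∈⁅x⁆; x∈⁅y⁆⇒x≡y; x∉⁅y⁆⇒x≢y; x∈p∪q⁺; x∈p∪q⁻; ∣p∣≤∣x∷p∣; ∣⁅x⁆∣≡1; ∣⊥∣≡0;
         p─q⊆p; x∈p∧x≢y⇒x∈p-y; x∈p⇒∣p-x∣<∣p∣)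
open import Data.Vec using (_∷_; []; there)
open import Data.Product using (∃; ∃₂; _×_; _,_; proj₁; proj₂)
open import Data.Sum using (_⊎_; inj₁; inj₂; [_,_])
open import Data.Empty using (⊥-elim)
open import Data.Unit using (⊤)
open import Relation.Nullary using (¬_; Dec; yes; no)
open import Relation.Nullary.Decidable using (_×-dec_; _⊎-dec_; _→-dec_; ¬?)
open import Relation.Binary.PropositionalEquality using (_≡_; _≢_; refl; sym; cong; subst)

∣p∪q∣≤∣p∣+∣q∣ : ∀ {n} (p q : Subset n) → ∣ p ∪ q ∣ ≤ ∣ p ∣ + ∣ q ∣
∣p∪q∣≤∣p∣+∣q∣ []            []            = z≤n
∣p∪q∣≤∣p∣+∣q∣ (inside ∷ p)  (s ∷ q)       =
  s≤s (≤-trans (∣p∪q∣≤∣p∣+∣q∣ p q) (+-monoʳ-≤ ∣ p ∣ (∣p∣≤∣x∷p∣ s q)))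
∣p∪q∣≤∣p∣+∣q∣ (outside ∷ p) (inside ∷ q)  =
  ≤-trans (s≤s (∣p∪q∣≤∣p∣+∣q∣ p q)) (≤-reflexive (sym (+-suc ∣ p ∣ ∣ q ∣)))
∣p∪q∣≤∣p∣+∣q∣ (outside ∷ p) (outside ∷ q) = ∣p∪q∣≤∣p∣+∣q∣ p q

∣⁅x⁆∪p∣≤1+∣p∣ : ∀ {n} (x : Fin n) (p : Subset n) → ∣ ⁅ x ⁆ ∪ p ∣ ≤ suc ∣ p ∣
∣⁅x⁆∪p∣≤1+∣p∣ x p =
  ≤-trans (∣p∪q∣≤∣p∣+∣q∣ ⁅ x ⁆ p) (≤-reflexive (cong (_+ ∣ p ∣) (∣⁅x⁆∣≡1 x)))

∣⁅x⁆∪⁅y⁆∪p∣≤2+∣p∣ : ∀ {n} (x y : Fin n) (p : Subset n) → ∣ ⁅ x ⁆ ∪ ⁅ y ⁆ ∪ p ∣ ≤ suc (suc ∣ p ∣)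
∣⁅x⁆∪⁅y⁆∪p∣≤2+∣p∣ x y p = ≤-trans (∣⁅x⁆∪p∣≤1+∣p∣ x (⁅ y ⁆ ∪ p)) (s≤s (∣⁅x⁆∪p∣≤1+∣p∣ y p))

x∉p-x : ∀ {n} (p : Subset n) x → x ∉ p - x
x∉p-x (_ ∷ p) Fin.zero    ()
x∉p-x (_ ∷ p) (Fin.suc x) (there x∈p-x) = x∉p-x p x x∈p-x

module Domination {n : ℕ} (G : Graph n) where
  open Graph G

  undominated : ∀ {k} → DomNumAtLeast G k → ∀ S → ∣ S ∣ < k →
    ∃ λ v → v ∉ S × (∀ u → u ∈ S → ¬ Adj u v)
  undominated γ≥k S ∣S∣<k
    with any? (λ v → ¬? (v ∈? S) ×-dec all? (λ u → u ∈? S →-dec ¬? (adj? u v)))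
  ... | yes witness = witness
  ... | no none     = ⊥-elim (<⇒≱ ∣S∣<k (γ≥k S S-dominates))
    where
    S-dominates : Dominates G S (λ _ → ⊤)
    S-dominates v _ v∉S with any? (λ u → u ∈? S ×-dec adj? u v)
    ... | yes neighbour = neighbour
    ... | no ¬neighbour = ⊥-elim (none (v , v∉S , λ u u∈S uv → ¬neighbour (u , u∈S , uv)))

  dominates-insert : ∀ {S T z} → Dominates G S (λ v → T v × ¬ Adj z v) →
    Dominates G (⁅ z ⁆ ∪ S) T
  dominates-insert {z = z} S-dom v Tv v∉zS with adj? z v
  ... | yes zv = z , x∈p∪q⁺ (inj₁ (x∈⁅x⁆ z)) , zv
  ... | no ¬zv with S-dom v (Tv , ¬zv) (λ v∈S → v∉zS (x∈p∪q⁺ (inj₂ v∈S)))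
  ...   | u , u∈S , uv = u , x∈p∪q⁺ (inj₂ u∈S) , uv

  dominates-remove : ∀ {S T z} → (∀ v → T v → v ≢ z) → Dominates G S T →
    Dominates G (S - z) (λ v → T v × ¬ Adj z v)
  dominates-remove {z = z} z∉T S-dom v (Tv , ¬zv) v∉S-z
    with S-dom v Tv (λ v∈S → v∉S-z (x∈p∧x≢y⇒x∈p-y v∈S (z∉T v Tv)))
  ... | u , u∈S , uv = u , x∈p∧x≢y⇒x∈p-y u∈S (λ { refl → ¬zv uv }) , uv

module AroundEdge {n : ℕ} (G : Graph n) (free : P3+P2-free G)
                  (x y : Fin n) (xy : Graph.Adj G x y) where
  open Graph G renaming (sym to adj-sym)
  open Edge G x y
  open Domination G using (undominated; dominates-insert; dominates-remove)

  adj⇒≢ : ∀ {u v} → Adj u v → u ≢ v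
  adj⇒≢ uv refl = irrefl uv

  Endpoint : Fin n → Set
  Endpoint w = w ≡ x ⊎ w ≡ y

  Gxy⇒≢endpoint : ∀ {v w} → Gxy v → Endpoint w → v ≢ w
  Gxy⇒≢endpoint (v≢x , _) (inj₁ refl) = v≢x
  Gxy⇒≢endpoint (_ , v≢y) (inj₂ refl) = v≢y

  B⇒¬adj-endpoint : ∀ {v w} → B v → Endpoint w → ¬ Adj v w
  B⇒¬adj-endpoint (_ , far) (inj₁ refl) vx = far (inj₁ vx)
  B⇒¬adj-endpoint (_ , far) (inj₂ refl) vy = far (inj₂ vy)

  A⇒¬B : ∀ {v} → A v → ¬ B v
  A⇒¬B (_ , near) (_ , far) = far near

  endpoint-neighbour : ∀ {z} → A z → ∃ λ w → Endpoint w × Adj z w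
  endpoint-neighbour (_ , inj₁ zx) = x , inj₁ refl , zx
  endpoint-neighbour (_ , inj₂ zy) = y , inj₂ refl , zy

  B? : ∀ v → Dec (B v)
  B? v = (¬? (v ≟ x) ×-dec ¬? (v ≟ y)) ×-dec ¬? (adj? v x ⊎-dec adj? v y)

  -- B_xy induces a disjoint union of cliques: an induced path p - q - r in B_xy
  -- together with the edge xy would be an induced P3+P2.
  B-transitive : ∀ {p q r} → B p → B q → B r → Adj p q → Adj q r → p ≢ r → Adj p r
  B-transitive {p} {q} {r} Bp Bq Br pq qr p≢r with adj? p r
  ... | yes pr = pr
  ... | no ¬pr = ⊥-elim (free p q r x y record
    { ab = adj⇒≢ pq ; ac = p≢r ; ad = ≢x Bp ; ae = ≢y Bp
    ; bc = adj⇒≢ qr ; bd = ≢x Bq ; be = ≢y Bq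
    ; cd = ≢x Br ; ce = ≢y Br ; de = adj⇒≢ xy
    ; e-ab = pq ; e-bc = qr ; e-de = xy
    ; n-ac = ¬pr ; n-ad = ¬x Bp ; n-ae = ¬y Bp
    ; n-bd = ¬x Bq ; n-be = ¬y Bq ; n-cd = ¬x Br ; n-ce = ¬y Br })
    where
    ≢x : ∀ {v} → B v → v ≢ x
    ≢x Bv = Gxy⇒≢endpoint (proj₁ Bv) (inj₁ refl)
    ≢y : ∀ {v} → B v → v ≢ y
    ≢y Bv = Gxy⇒≢endpoint (proj₁ Bv) (inj₂ refl)
    ¬x : ∀ {v} → B v → ¬ Adj v x
    ¬x Bv = B⇒¬adj-endpoint Bv (inj₁ refl)
    ¬y : ∀ {v} → B v → ¬ Adj v y
    ¬y Bv = B⇒¬adj-endpoint Bv (inj₂ refl)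

  -- A vertex z ∈ A_xy with a neighbour u ∈ B_xy, missing both ends of an edge
  -- bb' of B_xy: then u sees b or b', otherwise u - z - w (w ∈ {x, y} a
  -- neighbour of z) and bb' form an induced P3+P2.
  sees-edge : ∀ {z u b b'} → A z → B u → Adj z u →
    B b → B b' → Adj b b' → ¬ Adj z b → ¬ Adj z b' → Adj u b ⊎ Adj u b'
  sees-edge {z} {u} {b} {b'} Az Bu zu Bb Bb' bb' ¬zb ¬zb' with adj? u b | adj? u b'
  ... | yes ub | _       = inj₁ ub
  ... | no _   | yes ub' = inj₂ ub'
  ... | no ¬ub | no ¬ub' with endpoint-neighbour Az
  ...   | w , w-end , zw = ⊥-elim (free u z w b b' record
    { ab = λ { refl → irrefl zu } ; ac = Gxy⇒≢endpoint (proj₁ Bu) w-end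
    ; ad = λ { refl → ¬zb zu } ; ae = λ { refl → ¬zb' zu }
    ; bc = adj⇒≢ zw ; bd = λ { refl → A⇒¬B Az Bb } ; be = λ { refl → A⇒¬B Az Bb' }
    ; cd = λ { refl → Gxy⇒≢endpoint (proj₁ Bb) w-end refl }
    ; ce = λ { refl → Gxy⇒≢endpoint (proj₁ Bb') w-end refl } ; de = adj⇒≢ bb'
    ; e-ab = adj-sym zu ; e-bc = zw ; e-de = bb'
    ; n-ac = B⇒¬adj-endpoint Bu w-end ; n-ad = ¬ub ; n-ae = ¬ub'
    ; n-bd = ¬zb ; n-be = ¬zb'
    ; n-cd = λ wb → B⇒¬adj-endpoint Bb w-end (adj-sym wb)
    ; n-ce = λ wb' → B⇒¬adj-endpoint Bb' w-end (adj-sym wb') })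

  -- In the situation of sees-edge, u in fact sees both ends of the edge, since
  -- B_xy is a disjoint union of cliques.
  sees-both-ends : ∀ {z u b b'} → A z → B u → Adj z u →
    B b → B b' → Adj b b' → ¬ Adj z b → ¬ Adj z b' → Adj u b
  sees-both-ends Az Bu zu Bb Bb' bb' ¬zb ¬zb' with sees-edge Az Bu zu Bb Bb' bb' ¬zb ¬zb'
  ... | inj₁ ub  = ub
  ... | inj₂ ub' = B-transitive Bu Bb' Bb ub' (adj-sym bb') (λ { refl → ¬zb zu })

  MissedEdge : Fin n → Fin n → Fin n → Set
  MissedEdge z b b' = BminusN z b × BminusN z b' × Adj b b'

  IndependentOutside : Fin n → Set
  IndependentOutside z = ∀ b b' → BminusN z b → BminusN z b' → ¬ Adj b b'

  independent-or-missed : ∀ z → IndependentOutside z ⊎ ∃₂ (MissedEdge z)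
  independent-or-missed z
    with any? (λ b → any? (λ b' →
           (B? b ×-dec ¬? (adj? z b)) ×-dec (B? b' ×-dec ¬? (adj? z b')) ×-dec adj? b b'))
  ... | yes (b , b' , missed) = inj₂ (b , b' , missed)
  ... | no none = inj₁ λ b b' b-out b'-out bb' → none (b , b' , b-out , b'-out , bb')

  -- Indeed b₀ sees c and c', so
  -- v (being outside N[b₀] in a disjoint union of cliques) sees neither; if z
  -- missed an edge bb', then v would see b, and z could see neither c nor c'
  -- (else c would see b and hence v); now sees-edge makes v see c or c'.
  second-dominator-independent : ∀ {z₀ b₀ c c' z v} →
    A z₀ → B b₀ → Adj z₀ b₀ → MissedEdge z₀ c c' →
    A z → B v → Adj z v → v ≢ b₀ → ¬ Adj v b₀ → IndependentOutside z
  second-dominator-independent {b₀ = b₀} {c} {c'} {z} {v} Az₀ Bb₀ z₀b₀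
    ((Bc , ¬z₀c) , (Bc' , ¬z₀c') , cc') Az Bv zv v≢b₀ ¬vb₀ b b' (Bb , ¬zb) (Bb' , ¬zb') bb' =
    [ v-far Bc b₀c , v-far Bc' b₀c' ]
      (sees-edge Az Bv zv Bc Bc' cc' (z-misses Bc b₀c) (z-misses Bc' b₀c'))
    where
    b₀c : Adj b₀ c
    b₀c = sees-both-ends Az₀ Bb₀ z₀b₀ Bc Bc' cc' ¬z₀c ¬z₀c'
    b₀c' : Adj b₀ c'
    b₀c' = sees-both-ends Az₀ Bb₀ z₀b₀ Bc' Bc (adj-sym cc') ¬z₀c' ¬z₀c
    vb : Adj v b
    vb = sees-both-ends Az Bv zv Bb Bb' bb' ¬zb ¬zb'
    v-far : ∀ {d} → B d → Adj b₀ d → ¬ Adj v d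
    v-far Bd b₀d vd = ¬vb₀ (B-transitive Bv Bd Bb₀ vd (adj-sym b₀d) v≢b₀)
    -- z misses every neighbour d of b₀ in B_xy: otherwise d sees b, hence v sees d
    z-misses : ∀ {d} → B d → Adj b₀ d → ¬ Adj z d
    z-misses {d} Bd b₀d zd = v-far Bd b₀d (B-transitive Bv Bb Bd vb bd v≢d)
      where
      bd : Adj b d
      bd = adj-sym (sees-both-ends Az Bd zd Bb Bb' bb' ¬zb ¬zb')
      v≢d : v ≢ d
      v≢d refl = ¬vb₀ (adj-sym b₀d)

  -- As γ(G) ≥ 4, for every set S of at most one vertex, some vertex of B_xy lies
  -- outside N[S]: take a vertex undominated by {x, y} ∪ S.
  B-vertex-avoiding : DomNumAtLeast G 4 → ∀ S → ∣ S ∣ ≤ 1 →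
    ∃ λ v → B v × v ∉ S × (∀ u → u ∈ S → ¬ Adj u v)
  B-vertex-avoiding γ≥4 S ∣S∣≤1
    with v , v∉T , v-far ← undominated γ≥4 (⁅ x ⁆ ∪ ⁅ y ⁆ ∪ S)
           (s≤s (≤-trans (∣⁅x⁆∪⁅y⁆∪p∣≤2+∣p∣ x y S) (s≤s (s≤s ∣S∣≤1))))
    = v , ((v≢ x∈T , v≢ y∈T) , λ { (inj₁ vx) → v-far x x∈T (adj-sym vx)
                                ; (inj₂ vy) → v-far y y∈T (adj-sym vy) })
      , (λ v∈S → v∉T (S⊆T v∈S)) , (λ u u∈S → v-far u (S⊆T u∈S))
    where
    x∈T : x ∈ ⁅ x ⁆ ∪ ⁅ y ⁆ ∪ S
    x∈T = x∈p∪q⁺ (inj₁ (x∈⁅x⁆ x))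
    y∈T : y ∈ ⁅ x ⁆ ∪ ⁅ y ⁆ ∪ S
    y∈T = x∈p∪q⁺ (inj₂ (x∈p∪q⁺ (inj₁ (x∈⁅x⁆ y))))
    S⊆T : ∀ {u} → u ∈ S → u ∈ ⁅ x ⁆ ∪ ⁅ y ⁆ ∪ S
    S⊆T u∈S = x∈p∪q⁺ (inj₂ (x∈p∪q⁺ (inj₂ u∈S)))
    v≢ : ∀ {u} → u ∈ ⁅ x ⁆ ∪ ⁅ y ⁆ ∪ S → v ≢ u
    v≢ u∈T refl = v∉T u∈T

  B-dominator : ∀ {D} → (∀ v → v ∈ D → A v) → Dominates G D B →
    ∀ {v} → B v → ∃ λ z → z ∈ D × Adj z v
  B-dominator D⊆A D-dom {v} Bv = D-dom v Bv (λ v∈D → A⇒¬B (D⊆A v v∈D) Bv)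

  dominator-meets-A' : DomNumAtLeast G 4 → ∀ {D} → (∀ v → v ∈ D → A v) →
    Dominates G D B → ∃ λ z → z ∈ D × A' z
  dominator-meets-A' γ≥4 D⊆A D-dom
    with b₀ , Bb₀ , _ ← B-vertex-avoiding γ≥4 ⊥ (≤-trans (≤-reflexive (∣⊥∣≡0 n)) z≤n)
    with z₀ , z₀∈D , z₀b₀ ← B-dominator D⊆A D-dom Bb₀
    with independent-or-missed z₀
  ... | inj₁ independent₀ = z₀ , z₀∈D , D⊆A z₀ z₀∈D , (b₀ , Bb₀ , z₀b₀) , independent₀
  ... | inj₂ (_ , _ , missed)
    with v , Bv , v∉⁅b₀⁆ , b₀≁v ← B-vertex-avoiding γ≥4 ⁅ b₀ ⁆ (≤-reflexive (∣⁅x⁆∣≡1 b₀))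
    with z , z∈D , zv ← B-dominator D⊆A D-dom Bv
    = z , z∈D , D⊆A z z∈D , (v , Bv , zv) ,
      second-dominator-independent (D⊆A z₀ z₀∈D) Bb₀ z₀b₀ missed (D⊆A z z∈D) Bv zv
        (x∉⁅y⁆⇒x≢y v∉⁅b₀⁆) (λ vb₀ → b₀≁v b₀ (x∈⁅x⁆ b₀) (adj-sym vb₀))

  DomSetG : Subset n → Set
  DomSetG S = (∀ v → v ∈ S → A v) × Dominates G S B

  DomSetH : Fin n → Subset n → Set
  DomSetH z S = (∀ v → v ∈ S → A v × v ≢ z) × Dominates G S (BminusN z)

  extend-to-G : ∀ {z S} → A z → DomSetH z S → DomSetG (⁅ z ⁆ ∪ S)
  extend-to-G {z} {S} Az (S⊆A-z , S-dom) = ⊆A , dominates-insert S-dom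
    where
    ⊆A : ∀ v → v ∈ ⁅ z ⁆ ∪ S → A v
    ⊆A v v∈zS with x∈p∪q⁻ ⁅ z ⁆ S v∈zS
    ... | inj₁ v∈⁅z⁆ = subst A (sym (x∈⁅y⁆⇒x≡y z v∈⁅z⁆)) Az
    ... | inj₂ v∈S   = proj₁ (S⊆A-z v v∈S)

  restrict-to-H : ∀ {z D} → z ∈ D → DomSetG D → DomSetH z (D - z)
  restrict-to-H {z} {D} z∈D (D⊆A , D-dom) =
    (λ v v∈D-z → D⊆A v (p─q⊆p D ⁅ z ⁆ v∈D-z) , λ { refl → x∉p-x D z v∈D-z }) ,
    dominates-remove (λ v Bv → λ { refl → A⇒¬B (D⊆A z z∈D) Bv }) D-dom

  γ''G≤γ''H+1 : ∀ {k} → (∀ S → DomSetG S → k ≤ ∣ S ∣) →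
    ∀ {z S} → A z → DomSetH z S → k ≤ suc ∣ S ∣
  γ''G≤γ''H+1 G-min {z} {S} Az S-ok =
    ≤-trans (G-min (⁅ z ⁆ ∪ S) (extend-to-G Az S-ok)) (∣⁅x⁆∪p∣≤1+∣p∣ z S)

  γ''H-via-minimum : ∀ {k} → γ''Gxy k → ∀ {D z} → DomSetG D → ∣ D ∣ ≡ k → z ∈ D →
    γ''Hz z ∣ D - z ∣ × k ≡ suc ∣ D - z ∣
  γ''H-via-minimum {k} (_ , G-min) {D} {z} D-ok ∣D∣≡k z∈D =
    ((D - z , restrict-to-H z∈D D-ok , refl) ,
     (λ S S-ok → s≤s⁻¹ (subst (_≤ suc ∣ S ∣) k≡1+m (γ''G≤γ''H+1 G-min Az S-ok)))) ,
    k≡1+m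
    where
    Az : A z
    Az = proj₁ D-ok z z∈D
    k≡1+m : k ≡ suc ∣ D - z ∣
    k≡1+m = ≤-antisym (γ''G≤γ''H+1 G-min Az (restrict-to-H z∈D D-ok))
                      (subst (suc ∣ D - z ∣ ≤_) ∣D∣≡k (x∈p⇒∣p-x∣<∣p∣ z∈D))

lemma2 : ∀ {n} (G : Graph n) → Connected G → P3+P2-free G →
    (x y : Fin n) → Graph.Adj G x y →
    (∀ b → Edge.B G x y b → ∃ λ a → Edge.A G x y a × Graph.Adj G b a) →
    DomNumAtLeast G 4 →
    ∀ k → Edge.γ''Gxy G x y k →
      (∃ λ z → Edge.A' G x y z × ∃ λ m → Edge.γ''Hz G x y z m × k ≡ suc m)
      × (∀ z m → Edge.A' G x y z → Edge.γ''Hz G x y z m → k ≤ suc m)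
lemma2 G _ free x y xy _ γ≥4 k γ''=k@((D , D-ok , ∣D∣≡k) , G-min) =
  attained , lower-bound
  where
  open AroundEdge G free x y xy
  attained : ∃ λ z → Edge.A' G x y z × ∃ λ m → Edge.γ''Hz G x y z m × k ≡ suc m
  attained with z , z∈D , A'z ← dominator-meets-A' γ≥4 (proj₁ D-ok) (proj₂ D-ok) =
    z , A'z , ∣ D - z ∣ , γ''H-via-minimum γ''=k D-ok ∣D∣≡k z∈D
  lower-bound : ∀ z m → Edge.A' G x y z → Edge.γ''Hz G x y z m → k ≤ suc m
  lower-bound z m (Az , _) ((S , S-ok , refl) , _) = γ''G≤γ''H+1 G-min Az S-ok
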